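{- Let $(\Gamma,B)$ be a balanced graph and $v$ a vertex of $\Gamma$. Then either $m(v)=0$ and all three edges terminating at $v$ are primitive, or $m(v)>0$ and the number of primitive edges terminating at $v$ is even.
   Context: $\mathbb{Z}_2$ denotes the $2$-adic integers and $\nu_2$ the $2$-adic valuation ($\nu_2(0)=\infty$). A $3$-valent graph $\Gamma$ (multiple edges allowed) is regarded as directed by replacing each undirected edge by two opposite directed edges $e^+,e^-$; each vertex is the terminal vertex of exactly three directed edges. A balancing function $B$ assigns to each directed edge a vector $B(e)=(B_x(e),B_y(e))\in\mathbb{Z}_2\oplus\mathbb{Z}_2$ with $B(e^+)+B(e^-)=0$ and $B(e_1)+B(e_2)+B(e_3)=0$ for the three directed edges $e_1,e_2,e_3$ terminating at any vertex; $(\Gamma,B)$ is a balanced graph. The multiplicity of a vertex $v$ with terminating edges $e_1,e_2,e_3$ is $m(v)=\nu_2(B_x(e_1)B_y(e_2)-B_y(e_1)B_x(e_2))\in\mathbb{Z}_{\ge0}\cup\{\infty\}$. A vector in $\mathbb{Z}_2\oplus\mathbb{Z}_2$ is primitive if at least one of its coordinates is an odd $2$-adic integer (i.e. a unit); an edge is primitive if its balancing vector is primitive (this does not depend on the direction). -}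

module Defs where

open import Data.Nat using (ℕ; zero; suc; _+_; _*_; _∸_; _^_; _<_; _≟_)
open import Data.Nat.DivMod using (_%_)
open import Data.Nat.Properties using (m^n≢0)
open import Data.Fin using (Fin)
open import Data.Fin.Base using () renaming (zero to f0; suc to fs)
open import Data.List using (List; length; filter)
open import Data.List using () renaming (allFin to allFinL)
open import Data.Product using (Σ; _×_; proj₁; proj₂)
open import Data.Sum using (_⊎_)
open import Data.Unit using (⊤)
open import Data.Empty using (⊥)
open import Relation.Nullary using (¬_; Dec)
open import Relation.Nullary.Decidable using (_⊎-dec_)
open import Relation.Unary using (Decidable)
open import Relation.Binary.PropositionalEquality using (_≡_; _≢_)

-- 2-adic integers as the inverse limit  ℤ₂ = lim ℤ/2ⁿ :
-- a compatible sequence of residues  res n ∈ {0,…,2ⁿ-1}.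

_mod2^_ : ℕ → ℕ → ℕ
x mod2^ n = _%_ x (2 ^ n) {{m^n≢0 2 n}}

record ℤ₂ : Set where
  field
    res  : ℕ → ℕ
    res< : ∀ n → res n < 2 ^ n
    coh  : ∀ n → res (suc n) mod2^ n ≡ res n
open ℤ₂ public

-- A "residue sequence": the images of a 2-adic number in each ℤ/2ⁿ.
-- Ring operations are computed level-wise on residues.
Seq : Set
Seq = ℕ → ℕ

⌊_⌋ : ℤ₂ → Seq
⌊ a ⌋ = res a

_⊕_ : Seq → Seq → Seq
(s ⊕ t) n = (s n + t n) mod2^ n

_⊗_ : Seq → Seq → Seq
(s ⊗ t) n = (s n * t n) mod2^ n

-- s - t  (residues assumed reduced mod 2ⁿ)
_⊖_ : Seq → Seq → Seq
(s ⊖ t) n = (s n mod2^ n + (2 ^ n ∸ t n mod2^ n)) mod2^ n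

IsZero : Seq → Set
IsZero s = ∀ n → s n ≡ 0

data ℕ∞ : Set where
  fin : ℕ → ℕ∞
  ∞   : ℕ∞

Positive : ℕ∞ → Set
Positive (fin zero)    = ⊥
Positive (fin (suc _)) = ⊤
Positive ∞             = ⊤

-- ν₂ s ≃ k : the 2-adic valuation of (the number represented by) s is k.
-- ν₂ = k  iff  x ≡ 0 mod 2ᵏ and x ≢ 0 mod 2ᵏ⁺¹ ;  ν₂ = ∞ iff x = 0.
ν₂_≃_ : Seq → ℕ∞ → Set
ν₂ s ≃ fin k = (s k ≡ 0) × (s (suc k) ≢ 0)
ν₂ s ≃ ∞     = IsZero s

Odd₂ : ℤ₂ → Set
Odd₂ a = res a 1 ≡ 1

Odd₂? : (a : ℤ₂) → Dec (Odd₂ a)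
Odd₂? a = res a 1 ≟ 1

Vec₂ : Set
Vec₂ = ℤ₂ × ℤ₂

Primitive : Vec₂ → Set
Primitive w = Odd₂ (proj₁ w) ⊎ Odd₂ (proj₂ w)

Primitive? : Decidable Primitive
Primitive? w = Odd₂? (proj₁ w) ⊎-dec Odd₂? (proj₂ w)

-- 3-valent graphs (finite, multiple edges allowed), given by their
-- directed edges: each undirected edge = pair {e, rev e}.

record Graph3 : Set where
  field
    nV nE     : ℕ
    tgt       : Fin nE → Fin nV
    rev       : Fin nE → Fin nE
    rev-invol : ∀ e → rev (rev e) ≡ e
    rev-nofix : ∀ e → rev e ≢ e
    inc       : Fin nV → Fin 3 → Fin nE
    inc-tgt   : ∀ v i → tgt (inc v i) ≡ v
    inc-inj   : ∀ v i j → inc v i ≡ inc v j → i ≡ j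
    inc-surj  : ∀ e → Σ (Fin 3) (λ i → inc (tgt e) i ≡ e)
open Graph3 public

vx vy : Vec₂ → Seq
vx w = ⌊ proj₁ w ⌋
vy w = ⌊ proj₂ w ⌋

i0 i1 i2 : Fin 3
i0 = f0
i1 = fs f0
i2 = fs (fs f0)

record Balancing (Γ : Graph3) : Set where
  field
    B     : Fin (nE Γ) → Vec₂
    anti-x : ∀ e → IsZero (vx (B e) ⊕ vx (B (rev Γ e)))
    anti-y : ∀ e → IsZero (vy (B e) ⊕ vy (B (rev Γ e)))
    bal-x : ∀ v → IsZero ((vx (B (inc Γ v i0)) ⊕ vx (B (inc Γ v i1))) ⊕ vx (B (inc Γ v i2)))
    bal-y : ∀ v → IsZero ((vy (B (inc Γ v i0)) ⊕ vy (B (inc Γ v i1))) ⊕ vy (B (inc Γ v i2)))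
open Balancing public

det : {Γ : Graph3} → Balancing Γ → Fin (nV Γ) → Seq
det {Γ} β v = (vx e₁ ⊗ vy e₂) ⊖ (vy e₁ ⊗ vx e₂)
  where
  e₁ = B β (inc Γ v i0)
  e₂ = B β (inc Γ v i1)

mult_≃_ : {Γ : Graph3} → (Σ (Balancing Γ) (λ _ → Fin (nV Γ))) → ℕ∞ → Set
mult p ≃ k = ν₂ det (proj₁ p) (proj₂ p) ≃ k

numPrim : {Γ : Graph3} → Balancing Γ → Fin (nV Γ) → ℕ
numPrim {Γ} β v = length (filter (λ i → Primitive? (B β (inc Γ v i))) (allFinL 3))

-- Everything happens modulo 2. Reduction mod 2 is a ring map ℤ₂ → 𝔽₂, under
-- which a primitive vector becomes a nonzero vector of 𝔽₂², m(v) = 0 means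
-- that the reduced determinant is 1, and the balancing condition says that the
-- reductions u₀, u₁, u₂ of the three edges satisfy u₂ = u₀ + u₁. In 𝔽₂² the
-- number of nonzero vectors among u, w, u + w has the parity of det(u, w), and
-- if det(u, w) = 1 then u, w are independent, so none of u, w, u + w vanishes.
module Submission where

open import Defs
open import Data.Bool.Base using (Bool; true; false; _∧_; _∨_; _xor_)
open import Data.Nat.Base using (ℕ; zero; suc; _+_; _*_; _∸_; _^_; _<_; s≤s)
open import Data.Nat.Properties using (_≟_; 1+n≢0)
open import Data.Nat.Divisibility using (_∣_; divides)
open import Data.Nat.DivMod using (n%1≡0)
open import Data.Fin.Base using (Fin) renaming (zero to f0; suc to fs)
open import Data.List.Base using (List; []; _∷_; length; filter; map)
open import Data.Nat.ListAction using (sum)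
open import Data.Product.Base using (_×_; _,_; proj₁; proj₂)
open import Data.Sum.Base using (_⊎_; inj₁; inj₂)
open import Data.Unit.Base using (tt)
open import Relation.Nullary.Decidable using (Dec; does; _because_)
open import Relation.Nullary.Reflects using (invert)
open import Relation.Unary using (Pred; Decidable)
open import Relation.Binary.PropositionalEquality
  using (_≡_; refl; sym; trans; cong; cong₂; subst)

⌜_⌝ : Bool → ℕ
⌜ false ⌝ = 0
⌜ true  ⌝ = 1

n<2⇒n≡⌜n≟1⌝ : ∀ n → n < 2 → n ≡ ⌜ does (n ≟ 1) ⌝
n<2⇒n≡⌜n≟1⌝ 0 _ = refl
n<2⇒n≡⌜n≟1⌝ 1 _ = refl
n<2⇒n≡⌜n≟1⌝ (suc (suc _)) (s≤s (s≤s ()))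

parity : ℤ₂ → Bool
parity a = does (Odd₂? a)

⌜a⌝+⌜b⌝-mod2 : ∀ a b → (⌜ a ⌝ + ⌜ b ⌝) mod2^ 1 ≡ ⌜ a xor b ⌝
⌜a⌝+⌜b⌝-mod2 false false = refl
⌜a⌝+⌜b⌝-mod2 false true  = refl
⌜a⌝+⌜b⌝-mod2 true  false = refl
⌜a⌝+⌜b⌝-mod2 true  true  = refl

⌜a⌝*⌜b⌝-mod2 : ∀ a b → (⌜ a ⌝ * ⌜ b ⌝) mod2^ 1 ≡ ⌜ a ∧ b ⌝
⌜a⌝*⌜b⌝-mod2 false false = refl
⌜a⌝*⌜b⌝-mod2 false true  = refl
⌜a⌝*⌜b⌝-mod2 true  false = refl
⌜a⌝*⌜b⌝-mod2 true  true  = refl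

⌜a⌝-⌜b⌝-mod2 : ∀ a b → (⌜ a ⌝ mod2^ 1 + (2 ^ 1 ∸ ⌜ b ⌝ mod2^ 1)) mod2^ 1 ≡ ⌜ a xor b ⌝
⌜a⌝-⌜b⌝-mod2 false false = refl
⌜a⌝-⌜b⌝-mod2 false true  = refl
⌜a⌝-⌜b⌝-mod2 true  false = refl
⌜a⌝-⌜b⌝-mod2 true  true  = refl

record _≡₂_ (s : Seq) (a : Bool) : Set where
  constructor mod2
  field at-1 : s 1 ≡ ⌜ a ⌝
open _≡₂_

res≡₂parity : (a : ℤ₂) → ⌊ a ⌋ ≡₂ parity a
res≡₂parity a = mod2 (n<2⇒n≡⌜n≟1⌝ (res a 1) (res< a 1))

module _ {s t : Seq} {a b : Bool} (s≡a : s ≡₂ a) (t≡b : t ≡₂ b) where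

  private
    via : (f : ℕ → ℕ → ℕ) {c : Bool} → f ⌜ a ⌝ ⌜ b ⌝ ≡ ⌜ c ⌝ → f (s 1) (t 1) ≡ ⌜ c ⌝
    via f = trans (cong₂ f (at-1 s≡a) (at-1 t≡b))

  ⊕-mod2 : (s ⊕ t) ≡₂ (a xor b)
  ⊕-mod2 = mod2 (via (λ x y → (x + y) mod2^ 1) (⌜a⌝+⌜b⌝-mod2 a b))

  ⊗-mod2 : (s ⊗ t) ≡₂ (a ∧ b)
  ⊗-mod2 = mod2 (via (λ x y → (x * y) mod2^ 1) (⌜a⌝*⌜b⌝-mod2 a b))

  ⊖-mod2 : (s ⊖ t) ≡₂ (a xor b)
  ⊖-mod2 = mod2 (via (λ x y → (x mod2^ 1 + (2 ^ 1 ∸ y mod2^ 1)) mod2^ 1) (⌜a⌝-⌜b⌝-mod2 a b))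

⊖-at-0 : (s t : Seq) → (s ⊖ t) 0 ≡ 0
⊖-at-0 s t = n%1≡0 (s 0 mod2^ 0 + (2 ^ 0 ∸ t 0 mod2^ 0))

⌜⌝≡0⇒false : ∀ {a} → ⌜ a ⌝ ≡ 0 → a ≡ false
⌜⌝≡0⇒false {false} _ = refl

xor≡false⇒≡ : ∀ a b → a xor b ≡ false → b ≡ a
xor≡false⇒≡ false b  eq = eq
xor≡false⇒≡ true true _ = refl

balanced-mod2 : {s t r : Seq} {a b c : Bool} →
  s ≡₂ a → t ≡₂ b → r ≡₂ c → IsZero ((s ⊕ t) ⊕ r) → c ≡ a xor b
balanced-mod2 {a = a} {b} {c} s≡a t≡b r≡c s+t+r≡0 =
  xor≡false⇒≡ (a xor b) c
    (⌜⌝≡0⇒false (trans (sym (at-1 (⊕-mod2 (⊕-mod2 s≡a t≡b) r≡c))) (s+t+r≡0 1)))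

ν₂-positive : (s : Seq) → s 1 ≡ 0 → ∀ k → ν₂ s ≃ k → Positive k
ν₂-positive _ s₁≡0 (fin zero)    (_ , s₁≢0) = s₁≢0 s₁≡0
ν₂-positive _ _    (fin (suc _)) _          = tt
ν₂-positive _ _    ∞             _          = tt

Bool² : Set
Bool² = Bool × Bool

_+²_ : Bool² → Bool² → Bool²
(a , b) +² (c , d) = a xor c , b xor d

det² : Bool² → Bool² → Bool
det² (a , b) (c , d) = (a ∧ d) xor (b ∧ c)

nonzero : Bool² → Bool
nonzero (a , b) = a ∨ b

nonzero-parity≡det² : ∀ u w → nonzero u xor nonzero w xor nonzero (u +² w) ≡ det² u w
nonzero-parity≡det² (false , false) (false , false) = refl
nonzero-parity≡det² (false , false) (false , true)  = refl
nonzero-parity≡det² (false , false) (true  , false) = refl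
nonzero-parity≡det² (false , false) (true  , true)  = refl
nonzero-parity≡det² (false , true)  (false , false) = refl
nonzero-parity≡det² (false , true)  (false , true)  = refl
nonzero-parity≡det² (false , true)  (true  , false) = refl
nonzero-parity≡det² (false , true)  (true  , true)  = refl
nonzero-parity≡det² (true  , false) (false , false) = refl
nonzero-parity≡det² (true  , false) (false , true)  = refl
nonzero-parity≡det² (true  , false) (true  , false) = refl
nonzero-parity≡det² (true  , false) (true  , true)  = refl
nonzero-parity≡det² (true  , true)  (false , false) = refl
nonzero-parity≡det² (true  , true)  (false , true)  = refl
nonzero-parity≡det² (true  , true)  (true  , false) = refl
nonzero-parity≡det² (true  , true)  (true  , true)  = refl

det²≡true⇒nonzero : ∀ u w → det² u w ≡ true →
  nonzero u ≡ true × nonzero w ≡ true × nonzero (u +² w) ≡ true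
det²≡true⇒nonzero (false , false) _               ()
det²≡true⇒nonzero (false , true)  (false , false) ()
det²≡true⇒nonzero (false , true)  (false , true)  ()
det²≡true⇒nonzero (false , true)  (true  , false) _ = refl , refl , refl
det²≡true⇒nonzero (false , true)  (true  , true)  _ = refl , refl , refl
det²≡true⇒nonzero (true  , false) (false , false) ()
det²≡true⇒nonzero (true  , false) (false , true)  _ = refl , refl , refl
det²≡true⇒nonzero (true  , false) (true  , false) ()
det²≡true⇒nonzero (true  , false) (true  , true)  _ = refl , refl , refl
det²≡true⇒nonzero (true  , true)  (false , false) ()
det²≡true⇒nonzero (true  , true)  (false , true)  _ = refl , refl , refl
det²≡true⇒nonzero (true  , true)  (true  , false) _ = refl , refl , refl
det²≡true⇒nonzero (true  , true)  (true  , true)  ()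

even-if-xor≡false : ∀ a b c → a xor b xor c ≡ false → 2 ∣ sum (map ⌜_⌝ (a ∷ b ∷ c ∷ []))
even-if-xor≡false false false false _ = divides 0 refl
even-if-xor≡false false true  true  _ = divides 1 refl
even-if-xor≡false true  false true  _ = divides 1 refl
even-if-xor≡false true  true  false _ = divides 1 refl
even-if-xor≡false false false true  ()
even-if-xor≡false false true  false ()
even-if-xor≡false true  false false ()
even-if-xor≡false true  true  true  ()

length-filter≡sum : ∀ {a p} {A : Set a} {P : Pred A p} (P? : Decidable P) (xs : List A) →
  length (filter P? xs) ≡ sum (map (λ x → ⌜ does (P? x) ⌝) xs)
length-filter≡sum P? []       = refl
length-filter≡sum P? (x ∷ xs) with does (P? x)
... | false = length-filter≡sum P? xs
... | true  = cong suc (length-filter≡sum P? xs)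

reduce : Vec₂ → Bool²
reduce w = parity (proj₁ w) , parity (proj₂ w)

does≡true⇒ : ∀ {a} {A : Set a} (a? : Dec A) → does a? ≡ true → A
does≡true⇒ (true because [a]) _ = invert [a]

module AtVertex {Γ : Graph3} (β : Balancing Γ) (v : Fin (nV Γ)) where

  edge : Fin 3 → Vec₂
  edge i = B β (inc Γ v i)

  u : Fin 3 → Bool²
  u i = reduce (edge i)

  coord≡₂ : (p : Vec₂ → ℤ₂) (i : Fin 3) → ⌊ p (edge i) ⌋ ≡₂ parity (p (edge i))
  coord≡₂ p i = res≡₂parity (p (edge i))

  u₂≡u₀+u₁ : u i2 ≡ u i0 +² u i1
  u₂≡u₀+u₁ = cong₂ _,_
    (balanced-mod2 (coord≡₂ proj₁ i0) (coord≡₂ proj₁ i1) (coord≡₂ proj₁ i2) (bal-x β v))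
    (balanced-mod2 (coord≡₂ proj₂ i0) (coord≡₂ proj₂ i1) (coord≡₂ proj₂ i2) (bal-y β v))

  det≡₂det² : det β v ≡₂ det² (u i0) (u i1)
  det≡₂det² = ⊖-mod2 (⊗-mod2 (coord≡₂ proj₁ i0) (coord≡₂ proj₂ i1))
                     (⊗-mod2 (coord≡₂ proj₂ i0) (coord≡₂ proj₁ i1))

  det₀≡0 : det β v 0 ≡ 0
  det₀≡0 = ⊖-at-0 (vx (edge i0) ⊗ vy (edge i1)) (vy (edge i0) ⊗ vx (edge i1))

  numPrim≡ : numPrim β v ≡ sum (map (λ i → ⌜ nonzero (u i) ⌝) (i0 ∷ i1 ∷ i2 ∷ []))
  numPrim≡ = length-filter≡sum (λ i → Primitive? (edge i)) (i0 ∷ i1 ∷ i2 ∷ [])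

  det₁≡ : ∀ {d} → det² (u i0) (u i1) ≡ d → det β v 1 ≡ ⌜ d ⌝
  det₁≡ det²≡d = trans (at-1 det≡₂det²) (cong ⌜_⌝ det²≡d)

  primitive-parity≡det² : nonzero (u i0) xor nonzero (u i1) xor nonzero (u i2) ≡ det² (u i0) (u i1)
  primitive-parity≡det² =
    trans (cong (λ w → nonzero (u i0) xor nonzero (u i1) xor nonzero w) u₂≡u₀+u₁)
          (nonzero-parity≡det² (u i0) (u i1))

  det²-odd : det² (u i0) (u i1) ≡ true →
    mult (β , v) ≃ fin 0 × (∀ i → Primitive (edge i))
  det²-odd odd = (det₀≡0 , λ det₁≡0 → 1+n≢0 (trans (sym (det₁≡ odd)) det₁≡0)) , all-primitive
    where
    all-primitive : ∀ i → Primitive (edge i)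
    all-primitive i with det²≡true⇒nonzero (u i0) (u i1) odd
    all-primitive f0           | nz₀ , _   , _   = does≡true⇒ (Primitive? (edge i0)) nz₀
    all-primitive (fs f0)      | _   , nz₁ , _   = does≡true⇒ (Primitive? (edge i1)) nz₁
    all-primitive (fs (fs f0)) | _   , _   , nz₂ =
      does≡true⇒ (Primitive? (edge i2)) (trans (cong nonzero u₂≡u₀+u₁) nz₂)

  det²-even : det² (u i0) (u i1) ≡ false →
    (∀ k → mult (β , v) ≃ k → Positive k) × 2 ∣ numPrim β v
  det²-even even =
    ν₂-positive (det β v) (det₁≡ even) ,
    subst (2 ∣_) (sym numPrim≡)
      (even-if-xor≡false (nonzero (u i0)) (nonzero (u i1)) (nonzero (u i2))
        (trans primitive-parity≡det² even))

lemma1 : (Γ : Graph3) (β : Balancing Γ) (v : Fin (nV Γ)) →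
    ((mult (β , v) ≃ fin 0) × (∀ i → Primitive (B β (inc Γ v i))))
    ⊎ ((∀ k → mult (β , v) ≃ k → Positive k) × (2 ∣ numPrim β v))
lemma1 Γ β v = by-det² (det² (u i0) (u i1)) refl
  where
  open AtVertex β v
  by-det² : ∀ d → det² (u i0) (u i1) ≡ d →
    ((mult (β , v) ≃ fin 0) × (∀ i → Primitive (B β (inc Γ v i))))
    ⊎ ((∀ k → mult (β , v) ≃ k → Positive k) × (2 ∣ numPrim β v))
  by-det² true  odd  = inj₁ (det²-odd odd)
  by-det² false even = inj₂ (det²-even even)
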